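{- No $4$-regular graph of odd order is balanceable.
   Context: All graphs are finite, simple and undirected. A $2$-coloring of the edges of $K_n$ is a map $\varphi: E(K_n)\to\{R,B\}$; it contains a balanced copy of a graph $G$ if there is a subgraph of $K_n$ isomorphic to $G$ whose edge set can be partitioned into a red part $E_1$ and a blue part $E_2$ with $||E_1|-|E_2||\le 1$. $\mathrm{bal}(n,G)$ is the smallest integer, if it exists, with $\mathrm{bal}(n,G)<\lfloor \frac12\binom n2\rfloor$ such that every $2$-coloring of $E(K_n)$ with more than $\mathrm{bal}(n,G)$ red edges and more than $\mathrm{bal}(n,G)$ blue edges contains a balanced copy of $G$. $G$ is balanceable if there is $n_0$ such that $\mathrm{bal}(n,G)$ exists for all $n\ge n_0$. -}

module Defs where

open import Data.Nat using (ℕ; zero; suc; _+_; _≤_; _<_; _<ᵇ_; _/_)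
open import Data.Nat.Combinatorics using (_C_)
open import Data.Bool using (Bool; true; false; if_then_else_; _∧_; not)
open import Data.Fin using (Fin; toℕ)
open import Data.List using (List; map; allFin)
open import Data.Nat.ListAction using (sum)
open import Data.Product using (Σ; ∃; _×_)
open import Function.Definitions using (Injective)
open import Relation.Binary.PropositionalEquality using (_≡_)
open import Relation.Nullary using (¬_)

pairCount : (n : ℕ) → (Fin n → Fin n → Bool) → ℕ
pairCount n p =
  sum (map (λ i → sum (map (λ j → if (toℕ i <ᵇ toℕ j) ∧ p i j then 1 else 0)
                           (allFin n)))
           (allFin n))

degree : (m : ℕ) → (Fin m → Fin m → Bool) → Fin m → ℕ
degree m adj i = sum (map (λ j → if adj i j then 1 else 0) (allFin m))

record Graph : Set where
  field
    order : ℕ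
    adj   : Fin order → Fin order → Bool
    sym   : ∀ i j → adj i j ≡ adj j i
    irrefl : ∀ i → adj i i ≡ false
open Graph public

Regular : ℕ → Graph → Set
Regular k G = ∀ i → degree (order G) (adj G) i ≡ k

Odd : ℕ → Set
Odd m = Σ ℕ λ k → m ≡ suc (k + k)

-- A 2-colouring of E(K_n): true = red, false = blue; symmetric in its arguments
-- (the value on the diagonal is irrelevant).
Colouring : ℕ → Set
Colouring n = Fin n → Fin n → Bool

SymColouring : (n : ℕ) → Colouring n → Set
SymColouring n c = ∀ i j → c i j ≡ c j i

redEdges : (n : ℕ) → Colouring n → ℕ
redEdges n c = pairCount n c

blueEdges : (n : ℕ) → Colouring n → ℕ
blueEdges n c = pairCount n (λ i j → not (c i j))

BalancedCopy : (G : Graph) (n : ℕ) → Colouring n → Set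
BalancedCopy G n c =
  Σ (Fin (order G) → Fin n) λ f → Injective _≡_ _≡_ f ×
    (let r = pairCount (order G) (λ u v → adj G u v ∧ c (f u) (f v))
         b = pairCount (order G) (λ u v → adj G u v ∧ not (c (f u) (f v)))
     in (r ≤ b + 1) × (b ≤ r + 1))

BalThreshold : ℕ → Graph → ℕ → Set
BalThreshold n G b =
  (b < (n C 2) / 2) ×
  ((c : Colouring n) → SymColouring n c →
     b < redEdges n c → b < blueEdges n c → BalancedCopy G n c)

-- bal(n,G) exists (the smallest such natural b exists iff some exists).
BalExists : ℕ → Graph → Set
BalExists n G = ∃ λ b → BalThreshold n G b

Balanceable : Graph → Set
Balanceable G = ∃ λ n₀ → ∀ n → n₀ ≤ n → BalExists n G

-- Split the vertices of K_n, n = (2t+1)², into parts of sizes a = t(2t+1) and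
-- b = a + (2t+1), and colour red exactly the edges between the parts. As
-- (b − a)² = a + b, both colours then have ab = C(n,2)/2 edges, more than any
-- admissible threshold. The red edges of a copy of G are the edges of a cut of G,
-- and a cut is even when all degrees are even (Σ_{u∈S} deg u = 2e(S) + |cut S|);
-- but a balanced copy of a 4-regular G of odd order m must have exactly m of its
-- 2m edges red.

module Submission where

open import Data.Bool using (Bool; true; false; if_then_else_; _∧_; not; _xor_)
open import Data.Bool.Properties using (∧-comm; xor-comm; xor-same)
open import Data.Fin using (Fin; toℕ) renaming (zero to fzero; suc to fsuc)
open import Data.Fin.Properties using (toℕ-injective)
open import Data.List using (map; tabulate; allFin)
open import Data.List.Properties using (map-tabulate)
import Data.Nat.ListAction as List
open import Data.Nat using (ℕ; zero; suc; _+_; _*_; _≤_; _<_; _<ᵇ_; _/_; s≤s)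
open import Data.Nat.Combinatorics using (_C_; nC1≡n; nCk+nC[k+1]≡[n+1]C[k+1])
open import Data.Nat.Divisibility using (_∣_; divides; _∣0; ∣m∣n⇒∣m+n; ∣m+n∣m⇒∣n; m∣m*n)
open import Data.Nat.DivMod using (m*n/n≡m)
open import Data.Nat.Properties
open import Algebra.Properties.Semiring.Sum +-*-semiring
  using (sum-syntax; sum-cong-≗; ∑-distrib-+; ∑-comm; *-distribʳ-sum)
open import Data.Nat.Tactic.RingSolver using (solve-∀)
open import Data.Product using (Σ; _×_; _,_)
open import Function using (id; _∘_)
open import Relation.Binary using (tri<; tri≈; tri>)
open import Relation.Binary.PropositionalEquality
  using (_≡_; _≢_; refl; sym; trans; cong; cong₂; subst; module ≡-Reasoning)
open import Relation.Nullary using (¬_; contradiction)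

open import Defs hiding (sym)

𝟙 : Bool → ℕ
𝟙 b = if b then 1 else 0

sum-tabulate : ∀ {n} (f : Fin n → ℕ) → List.sum (tabulate f) ≡ ∑[ i < n ] f i
sum-tabulate {zero}  f = refl
sum-tabulate {suc n} f = cong (f fzero +_) (sum-tabulate (f ∘ fsuc))

sum-map-allFin : ∀ n (f : Fin n → ℕ) → List.sum (map f (allFin n)) ≡ ∑[ i < n ] f i
sum-map-allFin n f = trans (cong List.sum (map-tabulate id f)) (sum-tabulate f)

∑-const : ∀ n k → ∑[ i < n ] k ≡ n * k
∑-const zero    k = refl
∑-const (suc n) k = cong (k +_) (∑-const n k)

∣-∑ : ∀ {d n} {f : Fin n → ℕ} → (∀ i → d ∣ f i) → d ∣ ∑[ i < n ] f i
∣-∑ {d} {zero}  d∣f = d ∣0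
∣-∑ {d} {suc n} d∣f = ∣m∣n⇒∣m+n (d∣f fzero) (∣-∑ (d∣f ∘ fsuc))

∑-if : ∀ {n} (T : Fin n → Bool) x y →
       ∑[ i < n ] (if T i then x else y) ≡ (∑[ i < n ] 𝟙 (T i)) * x + (∑[ i < n ] 𝟙 (not (T i))) * y
∑-if {n} T x y = begin
  ∑[ i < n ] (if T i then x else y)
    ≡⟨ sum-cong-≗ (λ i → if≡𝟙-combination (T i)) ⟩
  ∑[ i < n ] (𝟙 (T i) * x + 𝟙 (not (T i)) * y)
    ≡⟨ ∑-distrib-+ (λ i → 𝟙 (T i) * x) (λ i → 𝟙 (not (T i)) * y) ⟩
  ∑[ i < n ] (𝟙 (T i) * x) + ∑[ i < n ] (𝟙 (not (T i)) * y)
    ≡⟨ sym (cong₂ _+_ (*-distribʳ-sum x (𝟙 ∘ T)) (*-distribʳ-sum y (𝟙 ∘ not ∘ T))) ⟩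
  (∑[ i < n ] 𝟙 (T i)) * x + (∑[ i < n ] 𝟙 (not (T i))) * y ∎
  where
  open ≡-Reasoning
  if≡𝟙-combination : ∀ b → (if b then x else y) ≡ 𝟙 b * x + 𝟙 (not b) * y
  if≡𝟙-combination true  = sym (trans (+-identityʳ (x + 0)) (+-identityʳ x))
  if≡𝟙-combination false = sym (+-identityʳ y)

∑-initialSegment : ∀ a b x y → ∑[ i < a + b ] (if toℕ i <ᵇ a then x else y) ≡ a * x + b * y
∑-initialSegment zero    b x y = ∑-const b y
∑-initialSegment (suc a) b x y =
  trans (cong (x +_) (∑-initialSegment a b x y)) (sym (+-assoc x (a * x) (b * y)))

orderedPairCount : (n : ℕ) → (Fin n → Fin n → Bool) → ℕ
orderedPairCount n p = ∑[ i < n ] ∑[ j < n ] 𝟙 (p i j)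

orderedPairCount-+ : ∀ n {p q r : Fin n → Fin n → Bool} →
  (∀ i j → 𝟙 (p i j) ≡ 𝟙 (q i j) + 𝟙 (r i j)) →
  orderedPairCount n p ≡ orderedPairCount n q + orderedPairCount n r
orderedPairCount-+ n {p} {q} {r} p≡q+r =
  trans (sum-cong-≗ (λ i → trans (sum-cong-≗ (p≡q+r i)) (∑-distrib-+ (𝟙 ∘ q i) (𝟙 ∘ r i))))
        (∑-distrib-+ (λ i → ∑[ j < n ] 𝟙 (q i j)) (λ i → ∑[ j < n ] 𝟙 (r i j)))

orderedPairCount-transpose : ∀ n (p : Fin n → Fin n → Bool) →
  orderedPairCount n (λ i j → p j i) ≡ orderedPairCount n p
orderedPairCount-transpose n p = ∑-comm (λ i j → 𝟙 (p j i))

pairCount≡orderedPairCount : ∀ n p →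
  pairCount n p ≡ orderedPairCount n (λ i j → (toℕ i <ᵇ toℕ j) ∧ p i j)
pairCount≡orderedPairCount n p =
  trans (sum-map-allFin n _) (sum-cong-≗ (λ i → sum-map-allFin n (λ j → 𝟙 ((toℕ i <ᵇ toℕ j) ∧ p i j))))

<⇒<ᵇ≡true : ∀ {m n} → m < n → (m <ᵇ n) ≡ true
<⇒<ᵇ≡true {zero}  {suc n} _         = refl
<⇒<ᵇ≡true {suc m} {suc n} (s≤s m<n) = <⇒<ᵇ≡true m<n

≤⇒<ᵇ≡false : ∀ {m n} → n ≤ m → (m <ᵇ n) ≡ false
≤⇒<ᵇ≡false {m}     {zero}  _         = refl
≤⇒<ᵇ≡false {suc m} {suc n} (s≤s n≤m) = ≤⇒<ᵇ≡false n≤m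

orderedPairCount≡2*pairCount : ∀ n (p : Fin n → Fin n → Bool) →
  (∀ i j → p i j ≡ p j i) → (∀ i → p i i ≡ false) →
  orderedPairCount n p ≡ 2 * pairCount n p
orderedPairCount≡2*pairCount n p p-sym p-irrefl = begin
  orderedPairCount n p                              ≡⟨ orderedPairCount-+ n split ⟩
  orderedPairCount n below + orderedPairCount n (λ i j → below j i)
    ≡⟨ cong (orderedPairCount n below +_) (orderedPairCount-transpose n below) ⟩
  orderedPairCount n below + orderedPairCount n below
    ≡⟨ cong₂ _+_ (sym (pairCount≡orderedPairCount n p)) (sym (pairCount≡orderedPairCount n p)) ⟩
  pairCount n p + pairCount n p                     ≡⟨ cong (pairCount n p +_) (sym (+-identityʳ _)) ⟩
  2 * pairCount n p                                 ∎
  where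
  open ≡-Reasoning
  below : Fin n → Fin n → Bool
  below i j = (toℕ i <ᵇ toℕ j) ∧ p i j
  split : ∀ i j → 𝟙 (p i j) ≡ 𝟙 (below i j) + 𝟙 (below j i)
  split i j with <-cmp (toℕ i) (toℕ j)
  ... | tri< i<j _ _ rewrite <⇒<ᵇ≡true i<j | ≤⇒<ᵇ≡false (<⇒≤ i<j) = sym (+-identityʳ _)
  ... | tri> _ _ j<i rewrite <⇒<ᵇ≡true j<i | ≤⇒<ᵇ≡false (<⇒≤ j<i) | p-sym j i = refl
  ... | tri≈ _ i≡j _ with toℕ-injective i≡j
  ... | refl rewrite ≤⇒<ᵇ≡false (≤-refl {toℕ i}) | p-irrefl i = refl

pairCount-split : ∀ n (p c : Fin n → Fin n → Bool) →
  pairCount n (λ i j → p i j ∧ c i j) + pairCount n (λ i j → p i j ∧ not (c i j)) ≡ pairCount n p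
pairCount-split n p c = begin
  pairCount n (λ i j → p i j ∧ c i j) + pairCount n (λ i j → p i j ∧ not (c i j))
    ≡⟨ cong₂ _+_ (pairCount≡orderedPairCount n _) (pairCount≡orderedPairCount n _) ⟩
  _ ≡⟨ sym (orderedPairCount-+ n (λ i j → split (toℕ i <ᵇ toℕ j) (p i j) (c i j))) ⟩
  _ ≡⟨ sym (pairCount≡orderedPairCount n p) ⟩
  pairCount n p ∎
  where
  open ≡-Reasoning
  split : ∀ x y z → 𝟙 (x ∧ y) ≡ 𝟙 (x ∧ (y ∧ z)) + 𝟙 (x ∧ (y ∧ not z))
  split false y     z     = refl
  split true  false z     = refl
  split true  true  false = refl
  split true  true  true  = refl

pairCount-complete : ∀ n → pairCount n (λ _ _ → true) ≡ n C 2
pairCount-complete zero    = refl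
pairCount-complete (suc n) = begin
  pairCount (suc n) (λ _ _ → true)
    ≡⟨ pairCount≡orderedPairCount (suc n) _ ⟩
  (∑[ j < n ] 1) + orderedPairCount n (λ i j → (toℕ i <ᵇ toℕ j) ∧ true)
    ≡⟨ cong₂ _+_ (trans (∑-const n 1) (*-identityʳ n)) (sym (pairCount≡orderedPairCount n _)) ⟩
  n + pairCount n (λ _ _ → true)  ≡⟨ cong₂ _+_ (sym (nC1≡n n)) (pairCount-complete n) ⟩
  n C 1 + n C 2                   ≡⟨ nCk+nC[k+1]≡[n+1]C[k+1] n 1 ⟩
  suc n C 2                       ∎
  where open ≡-Reasoning

2*nC2+n≡n*n : ∀ n → 2 * (n C 2) + n ≡ n * n
2*nC2+n≡n*n zero    = refl
2*nC2+n≡n*n (suc n) = begin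
  2 * (suc n C 2) + suc n            ≡⟨ cong (λ c → 2 * c + suc n) (sym (nCk+nC[k+1]≡[n+1]C[k+1] n 1)) ⟩
  2 * (n C 1 + n C 2) + suc n        ≡⟨ cong (λ c → 2 * (c + n C 2) + suc n) (nC1≡n n) ⟩
  2 * (n + n C 2) + suc n            ≡⟨ regroup n (n C 2) ⟩
  suc (n + n + (2 * (n C 2) + n))    ≡⟨ cong (λ s → suc (n + n + s)) (2*nC2+n≡n*n n) ⟩
  suc (n + n + n * n)                ≡⟨ square-suc n ⟩
  suc n * suc n                      ∎
  where
  open ≡-Reasoning
  regroup : ∀ n c → 2 * (n + c) + suc n ≡ suc (n + n + (2 * c + n))
  regroup = solve-∀
  square-suc : ∀ n → suc (n + n + n * n) ≡ suc n * suc n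
  square-suc = solve-∀

consecutive-sum-odd : ∀ {m n o} → m < n → n ≤ m + 1 → m + n ≢ 2 * o
consecutive-sum-odd {m} {n} {o} m<n n≤m+1 m+n≡2o = even≢odd o m (begin
  2 * o        ≡⟨ sym m+n≡2o ⟩
  m + n        ≡⟨ cong (m +_) n≡1+m ⟩
  m + suc m    ≡⟨ +-suc m m ⟩
  suc (m + m)  ≡⟨ cong (λ k → suc (m + k)) (sym (+-identityʳ m)) ⟩
  suc (2 * m)  ∎)
  where
  open ≡-Reasoning
  n≡1+m : n ≡ suc m
  n≡1+m = ≤-antisym (subst (n ≤_) (+-comm m 1) n≤m+1) m<n

half-of-close-pair : ∀ {m n o} → m ≤ n + 1 → n ≤ m + 1 → m + n ≡ 2 * o → m ≡ o
half-of-close-pair {m} {n} {o} m≤n+1 n≤m+1 m+n≡2o with <-cmp m n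
... | tri< m<n _ _ = contradiction m+n≡2o (consecutive-sum-odd {o = o} m<n n≤m+1)
... | tri> _ _ n<m = contradiction (trans (+-comm n m) m+n≡2o) (consecutive-sum-odd {o = o} n<m m≤n+1)
... | tri≈ _ refl _ = *-cancelˡ-≡ m o 2 (trans (cong (m +_) (+-identityʳ m)) m+n≡2o)

odd⇒∤2 : ∀ {m} → Odd m → ¬ 2 ∣ m
odd⇒∤2 {m} (k , m≡1+2k) (divides q m≡q*2) = even≢odd q k (begin
  2 * q        ≡⟨ *-comm 2 q ⟩
  q * 2        ≡⟨ sym m≡q*2 ⟩
  m            ≡⟨ m≡1+2k ⟩
  suc (k + k)  ≡⟨ cong (λ j → suc (k + j)) (sym (+-identityʳ k)) ⟩
  suc (2 * k)  ∎)
  where open ≡-Reasoning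

edgeCount : Graph → ℕ
edgeCount G = pairCount (order G) (adj G)

cutSize : (G : Graph) → (Fin (order G) → Bool) → ℕ
cutSize G S = pairCount (order G) (λ u v → adj G u v ∧ (S u xor S v))

degree≡∑ : ∀ G u → degree (order G) (adj G) u ≡ ∑[ v < order G ] 𝟙 (adj G u v)
degree≡∑ G u = sum-map-allFin (order G) (λ v → 𝟙 (adj G u v))

degree-sum≡2*edgeCount : ∀ G → ∑[ u < order G ] degree (order G) (adj G) u ≡ 2 * edgeCount G
degree-sum≡2*edgeCount G =
  trans (sum-cong-≗ (degree≡∑ G))
        (orderedPairCount≡2*pairCount (order G) (adj G) (Graph.sym G) (irrefl G))

regular⇒2*edgeCount≡order*k : ∀ {k} G → Regular k G → 2 * edgeCount G ≡ order G * k
regular⇒2*edgeCount≡order*k {k} G reg =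
  trans (sym (degree-sum≡2*edgeCount G)) (trans (sum-cong-≗ reg) (∑-const (order G) k))

leaving : (G : Graph) → (Fin (order G) → Bool) → Fin (order G) → Fin (order G) → Bool
leaving G S u v = adj G u v ∧ (S u ∧ not (S v))

cutSize≡orderedPairCount-leaving : ∀ G S → cutSize G S ≡ orderedPairCount (order G) (leaving G S)
cutSize≡orderedPairCount-leaving G S = *-cancelˡ-≡ _ _ 2 (begin
  2 * cutSize G S
    ≡⟨ sym (orderedPairCount≡2*pairCount m _
             (λ u v → cong₂ _∧_ (Graph.sym G u v) (xor-comm (S u) (S v)))
             (λ u → cong (_∧ (S u xor S u)) (irrefl G u))) ⟩
  orderedPairCount m (λ u v → adj G u v ∧ (S u xor S v))
    ≡⟨ orderedPairCount-+ m across≡leaving-both-ways ⟩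
  orderedPairCount m (leaving G S) + orderedPairCount m (λ u v → leaving G S v u)
    ≡⟨ cong (orderedPairCount m (leaving G S) +_) (orderedPairCount-transpose m (leaving G S)) ⟩
  orderedPairCount m (leaving G S) + orderedPairCount m (leaving G S)
    ≡⟨ cong (orderedPairCount m (leaving G S) +_) (sym (+-identityʳ _)) ⟩
  2 * orderedPairCount m (leaving G S) ∎)
  where
  open ≡-Reasoning
  m = order G
  across≡leaving-both-ways : ∀ u v →
    𝟙 (adj G u v ∧ (S u xor S v)) ≡ 𝟙 (leaving G S u v) + 𝟙 (leaving G S v u)
  across≡leaving-both-ways u v rewrite Graph.sym G v u with S u | S v | adj G u v
  ... | _     | _     | false = refl
  ... | false | false | true  = refl
  ... | false | true  | true  = refl
  ... | true  | false | true  = refl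
  ... | true  | true  | true  = refl

degree-sum-within : ∀ G (S : Fin (order G) → Bool) →
  ∑[ u < order G ] (if S u then degree (order G) (adj G) u else 0)
    ≡ 2 * pairCount (order G) (λ u v → adj G u v ∧ (S u ∧ S v)) + cutSize G S
degree-sum-within G S = begin
  ∑[ u < m ] (if S u then degree m (adj G) u else 0)
    ≡⟨ sum-cong-≗ row ⟩
  orderedPairCount m (λ u v → S u ∧ adj G u v)
    ≡⟨ orderedPairCount-+ m split-by-S ⟩
  orderedPairCount m inside + orderedPairCount m (leaving G S)
    ≡⟨ cong₂ _+_ (orderedPairCount≡2*pairCount m inside inside-sym inside-irrefl)
                 (sym (cutSize≡orderedPairCount-leaving G S)) ⟩
  2 * pairCount m inside + cutSize G S ∎
  where
  open ≡-Reasoning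
  m = order G
  inside : Fin m → Fin m → Bool
  inside u v = adj G u v ∧ (S u ∧ S v)
  inside-sym : ∀ u v → inside u v ≡ inside v u
  inside-sym u v = cong₂ _∧_ (Graph.sym G u v) (∧-comm (S u) (S v))
  inside-irrefl : ∀ u → inside u u ≡ false
  inside-irrefl u = cong (_∧ (S u ∧ S u)) (irrefl G u)
  row : ∀ u → (if S u then degree m (adj G) u else 0) ≡ ∑[ v < m ] 𝟙 (S u ∧ adj G u v)
  row u with S u
  ... | true  = degree≡∑ G u
  ... | false = sym (trans (∑-const m 0) (*-zeroʳ m))
  split-by-S : ∀ u v → 𝟙 (S u ∧ adj G u v) ≡ 𝟙 (inside u v) + 𝟙 (leaving G S u v)
  split-by-S u v with S u | S v | adj G u v
  ... | false | _     | false = refl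
  ... | false | _     | true  = refl
  ... | true  | _     | false = refl
  ... | true  | false | true  = refl
  ... | true  | true  | true  = refl

cutSize-even : ∀ G → (∀ u → 2 ∣ degree (order G) (adj G) u) → ∀ S → 2 ∣ cutSize G S
cutSize-even G even-degree S = ∣m+n∣m⇒∣n
  (subst (2 ∣_) (degree-sum-within G S) (∣-∑ even-row))
  (m∣m*n (pairCount (order G) (λ u v → adj G u v ∧ (S u ∧ S v))))
  where
  even-row : ∀ u → 2 ∣ (if S u then degree (order G) (adj G) u else 0)
  even-row u with S u
  ... | true  = even-degree u
  ... | false = 2 ∣0

crossing : ∀ {n} → (Fin n → Bool) → Colouring n
crossing T i j = T i xor T j

crossing-sym : ∀ {n} (T : Fin n → Bool) → SymColouring n (crossing T)
crossing-sym T i j = xor-comm (T i) (T j)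

no-balanced-copy-in-crossing : ∀ G → (∀ u → 2 ∣ degree (order G) (adj G) u) →
  ∀ {m} → edgeCount G ≡ 2 * m → ¬ 2 ∣ m →
  ∀ {n} (T : Fin n → Bool) → ¬ BalancedCopy G n (crossing T)
no-balanced-copy-in-crossing G even-degree {m} e≡2m m-odd T (f , _ , r≤b+1 , b≤r+1) =
  m-odd (subst (2 ∣_) cut≡m (cutSize-even G even-degree (T ∘ f)))
  where
  cut≡m : cutSize G (T ∘ f) ≡ m
  cut≡m = half-of-close-pair r≤b+1 b≤r+1
    (trans (pairCount-split (order G) (adj G) (λ u v → crossing T (f u) (f v))) e≡2m)

redEdges+blueEdges : ∀ n (c : Colouring n) → redEdges n c + blueEdges n c ≡ n C 2
redEdges+blueEdges n c = trans (pairCount-split n (λ _ _ → true) c) (pairCount-complete n)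

redEdges-crossing : ∀ n (T : Fin n → Bool) →
  redEdges n (crossing T) ≡ (∑[ i < n ] 𝟙 (T i)) * (∑[ i < n ] 𝟙 (not (T i)))
redEdges-crossing n T = *-cancelˡ-≡ _ _ 2 (begin
  2 * redEdges n (crossing T)
    ≡⟨ sym (orderedPairCount≡2*pairCount n (crossing T) (crossing-sym T) (λ i → xor-same (T i))) ⟩
  orderedPairCount n (crossing T)          ≡⟨ sum-cong-≗ row ⟩
  ∑[ i < n ] (if T i then outT else inT)   ≡⟨ ∑-if T outT inT ⟩
  inT * outT + outT * inT                  ≡⟨ cong (inT * outT +_) (trans (*-comm outT inT) (sym (+-identityʳ _))) ⟩
  2 * (inT * outT)                         ∎)
  where
  open ≡-Reasoning
  inT outT : ℕ
  inT  = ∑[ i < n ] 𝟙 (T i)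
  outT = ∑[ i < n ] 𝟙 (not (T i))
  row : ∀ i → ∑[ j < n ] 𝟙 (T i xor T j) ≡ (if T i then outT else inT)
  row i with T i
  ... | true  = refl
  ... | false = refl

initialSegment : ∀ a b → Fin (a + b) → Bool
initialSegment a b i = toℕ i <ᵇ a

redEdges-initialSegment : ∀ a b → redEdges (a + b) (crossing (initialSegment a b)) ≡ a * b
redEdges-initialSegment a b =
  trans (redEdges-crossing (a + b) (initialSegment a b)) (cong₂ _*_ inside≡a outside≡b)
  where
  inside≡a : ∑[ i < a + b ] 𝟙 (toℕ i <ᵇ a) ≡ a
  inside≡a = trans (∑-initialSegment a b 1 0)
                   (trans (cong₂ _+_ (*-identityʳ a) (*-zeroʳ b)) (+-identityʳ a))
  𝟙-not : ∀ x → 𝟙 (not x) ≡ (if x then 0 else 1)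
  𝟙-not true  = refl
  𝟙-not false = refl
  outside≡b : ∑[ i < a + b ] 𝟙 (not (toℕ i <ᵇ a)) ≡ b
  outside≡b = trans (sum-cong-≗ {a + b} (λ i → 𝟙-not (toℕ i <ᵇ a)))
              (trans (∑-initialSegment a b 0 1)
                     (cong₂ _+_ (*-zeroʳ a) (*-identityʳ b)))

balanced-crossing-colouring : ∀ t → Σ ℕ λ n → t ≤ n × Σ (Fin n → Bool) λ T →
  redEdges n (crossing T) ≡ (n C 2) / 2 × blueEdges n (crossing T) ≡ (n C 2) / 2
balanced-crossing-colouring t =
  a + b , t≤a+b , initialSegment a b , trans red≡ab (sym half≡ab) , trans blue≡ab (sym half≡ab)
  where
  d a b : ℕ
  d = suc (2 * t)
  a = t * d
  b = a + d
  d²≡a+b : d * d ≡ a + b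
  d²≡a+b = lemma t
    where
    lemma : ∀ t → suc (2 * t) * suc (2 * t) ≡ t * suc (2 * t) + (t * suc (2 * t) + suc (2 * t))
    lemma = solve-∀
  t≤a+b : t ≤ a + b
  t≤a+b = ≤-trans (m≤m+n t (t + 0)) (≤-trans (n≤1+n (2 * t)) (≤-trans (m≤n+m d a) (m≤n+m b a)))
  nC2≡2ab : (a + b) C 2 ≡ 2 * (a * b)
  nC2≡2ab = *-cancelˡ-≡ _ _ 2 (+-cancelʳ-≡ (a + b) _ _ (begin
    2 * ((a + b) C 2) + (a + b)  ≡⟨ 2*nC2+n≡n*n (a + b) ⟩
    (a + b) * (a + b)            ≡⟨ square-of-sum a d ⟩
    2 * (2 * (a * b)) + d * d    ≡⟨ cong (2 * (2 * (a * b)) +_) d²≡a+b ⟩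
    2 * (2 * (a * b)) + (a + b)  ∎))
    where
    open ≡-Reasoning
    square-of-sum : ∀ a d → (a + (a + d)) * (a + (a + d)) ≡ 2 * (2 * (a * (a + d))) + d * d
    square-of-sum = solve-∀
  half≡ab : ((a + b) C 2) / 2 ≡ a * b
  half≡ab = trans (cong (_/ 2) (trans nC2≡2ab (*-comm 2 (a * b)))) (m*n/n≡m (a * b) 2)
  red≡ab : redEdges (a + b) (crossing (initialSegment a b)) ≡ a * b
  red≡ab = redEdges-initialSegment a b
  blue≡ab : blueEdges (a + b) (crossing (initialSegment a b)) ≡ a * b
  blue≡ab = +-cancelˡ-≡ (a * b) _ _ (begin
    a * b + blueEdges (a + b) (crossing (initialSegment a b))
      ≡⟨ cong (_+ blueEdges (a + b) (crossing (initialSegment a b))) (sym red≡ab) ⟩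
    redEdges (a + b) (crossing (initialSegment a b)) + blueEdges (a + b) (crossing (initialSegment a b))
      ≡⟨ redEdges+blueEdges (a + b) (crossing (initialSegment a b)) ⟩
    (a + b) C 2                   ≡⟨ nC2≡2ab ⟩
    2 * (a * b)                   ≡⟨ cong (a * b +_) (+-identityʳ (a * b)) ⟩
    a * b + a * b                 ∎)
    where open ≡-Reasoning

4-regular⇒edgeCount≡2*order : ∀ G → Regular 4 G → edgeCount G ≡ 2 * order G
4-regular⇒edgeCount≡2*order G reg =
  *-cancelˡ-≡ _ _ 2 (trans (regular⇒2*edgeCount≡order*k G reg)
                            (trans (*-comm (order G) 4) (*-assoc 2 2 (order G))))

corollary6p1 : (G : Graph) → Regular 4 G → Odd (order G) → ¬ Balanceable G
corollary6p1 G reg odd (n₀ , bal) with balanced-crossing-colouring n₀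
... | n , n₀≤n , T , red≡half , blue≡half with bal n n₀≤n
... | b₀ , b₀<half , threshold =
  no-balanced-copy-in-crossing G (λ u → divides 2 (reg u)) (4-regular⇒edgeCount≡2*order G reg) (odd⇒∤2 odd) T
    (threshold (crossing T) (crossing-sym T)
      (subst (b₀ <_) (sym red≡half) b₀<half) (subst (b₀ <_) (sym blue≡half) b₀<half))
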